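{- Let $n>1$ be a squarefree integer. If $n/P(n)$ is strictly $2$-dense and $P(n)<\sqrt{n}$, then $n$ is strictly $2$-dense.
   Context: $P(n)$ denotes the largest prime factor of $n$. For a positive integer $n$ let $1=d_1<d_2<\cdots<d_{\tau(n)}=n$ be its positive divisors in increasing order, where $\tau(n)$ is the number of divisors. A squarefree integer $n$ is strictly $2$-dense if $d_{i+1}/d_i<2$ for all $i$ with $1<i<\tau(n)-1$, and $d_2/d_1=2=d_{\tau(n)}/d_{\tau(n)-1}$ (in particular $n$ is even). -}

module Defs where

open import Data.Nat using (ℕ; _*_; _≤_; _<_)
open import Data.Nat.Divisibility using (_∣_)
open import Data.Nat.Primality using (Prime)
open import Data.Product using (_×_)
open import Relation.Binary.PropositionalEquality using (_≡_; _≢_)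

Squarefree : ℕ → Set
Squarefree n = ∀ d → d * d ∣ n → d ≡ 1

IsLargestPrimeFactor : ℕ → ℕ → Set
IsLargestPrimeFactor p n = Prime p × p ∣ n × (∀ q → Prime q → q ∣ n → q ≤ p)

ConsecutiveDivisors : ℕ → ℕ → ℕ → Set
ConsecutiveDivisors n d d' =
  d ∣ n × d' ∣ n × d < d' × (∀ e → e ∣ n → d < e → e < d' → Data.Empty.⊥)
  where import Data.Empty

-- Strictly 2-dense (n squarefree is a separate hypothesis):
--  * d_{i+1}/d_i < 2 for consecutive divisors with d_i ≠ 1 (i > 1) and d_{i+1} ≠ n (i+1 < τ(n));
--  * d_2/d_1 = 2, i.e. the divisor following 1 is 2;
--  * d_τ/d_{τ-1} = 2, i.e. the divisor preceding n is n/2.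
record Strictly2Dense (n : ℕ) : Set where
  field
    inner  : ∀ d d' → ConsecutiveDivisors n d d' → d ≢ 1 → d' ≢ n → d' < 2 * d
    first  : ConsecutiveDivisors n 1 2
    last   : ∀ d → ConsecutiveDivisors n d n → n ≡ 2 * d

module Submission where

open import Defs
open import Data.Nat using (ℕ; _*_; _<_)
open import Relation.Binary.PropositionalEquality using (_≡_)

open import Data.Nat using (zero; suc; _+_; _∸_; _≤_; z≤n; s≤s; NonZero; nonTrivial⇒n>1; _≟_; _<?_)
open import Data.Nat.Properties
open import Data.Nat.Divisibility
open import Data.Nat.Primality using (prime⇒nonZero; prime⇒nonTrivial)
open import Data.Product using (_×_; _,_; proj₁; proj₂; ∃-syntax)
open import Data.Sum using (inj₁; inj₂)
open import Data.Empty using (⊥; ⊥-elim)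
open import Relation.Nullary using (¬_; yes; no)
open import Relation.Binary.Definitions using (tri<; tri≈; tri>)
open import Relation.Binary.PropositionalEquality using (_≢_; refl; sym; trans; cong; subst)

-- Write n = m p with m = n / P(n) strictly 2-dense.
-- Squarefreeness gives p ∤ m, and p² < n gives p < m.  Since 2 ∣ m ∣ n, the
-- conditions on the first and last gap of n hold for every even n.  For an
-- inner gap d < d' it suffices to exhibit a divisor e of n with d < e < 2d.
-- The tool for this is an approximation property of strictly 2-dense m:
-- walking up the chain of divisors of m, the first one with k c > a satisfies
-- a < k c < 2a whenever c < a and 2a < m c.  Applied with c = p (if p < d)
-- or c = 1 (if 2d < m) it yields e; the remaining cases d < p and d = p are
-- settled by e = p and e = m.

DivisorGap : ℕ → ℕ → ℕ → Set
DivisorGap n d e = ∀ x → x ∣ n → d < x → x < e → ⊥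

gap-succ : ∀ {n d} → DivisorGap n d (suc d)
gap-succ x _ d<x x<1+d = <-irrefl refl (<-≤-trans d<x (≤-pred x<1+d))

gap-extend : ∀ {n d e} → DivisorGap n d e → ¬ e ∣ n → DivisorGap n d (suc e)
gap-extend {e = e} gap e∤n x x∣n d<x x<1+e with m≤n⇒m<n∨m≡n (≤-pred x<1+e)
... | inj₁ x<e = gap x x∣n d<x x<e
... | inj₂ refl = e∤n x∣n

successor-unique : ∀ {n d e₁ e₂} →
  ConsecutiveDivisors n d e₁ → ConsecutiveDivisors n d e₂ → e₁ ≡ e₂
successor-unique (_ , e₁∣n , d<e₁ , gap₁) (_ , e₂∣n , d<e₂ , gap₂) with <-cmp _ _
... | tri< e₁<e₂ _ _ = ⊥-elim (gap₂ _ e₁∣n d<e₁ e₁<e₂)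
... | tri≈ _ e₁≡e₂ _ = e₁≡e₂
... | tri> _ _ e₂<e₁ = ⊥-elim (gap₁ _ e₂∣n d<e₂ e₂<e₁)

successor-bound : ∀ {n d d' e} → ConsecutiveDivisors n d d' →
  e ∣ n → d < e → e < 2 * d → d' < 2 * d
successor-bound (_ , _ , _ , gap) e∣n d<e e<2d =
  ≤-<-trans (≮⇒≥ (gap _ e∣n d<e)) e<2d

proper-divisor-bound : ∀ {n e} → 0 < n → e ∣ n → e ≢ n → 2 * e ≤ n
proper-divisor-bound () (divides zero refl) _
proper-divisor-bound {e = e} _ (divides 1 refl) e≢n = ⊥-elim (e≢n (sym (+-identityʳ e)))
proper-divisor-bound {e = e} _ (divides (suc (suc q)) refl) _ =
  *-monoˡ-≤ e {2} {2 + q} (s≤s (s≤s z≤n))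

inner-gap-below-half : ∀ {n d d'} → 0 < n → ConsecutiveDivisors n d d' → d' ≢ n →
  2 * d < n
inner-gap-below-half 0<n (_ , d'∣n , d<d' , _) d'≢n =
  <-≤-trans (*-monoʳ-< 2 d<d') (proper-divisor-bound 0<n d'∣n d'≢n)

nontrivial-divisor : ∀ {n d} → 0 < n → d ∣ n → d ≢ 1 → 1 < d
nontrivial-divisor {d = zero} 0<n 0∣n _ = ⊥-elim (<-irrefl (sym (0∣⇒≡0 0∣n)) 0<n)
nontrivial-divisor {d = 1} _ _ d≢1 = ⊥-elim (d≢1 refl)
nontrivial-divisor {d = suc (suc _)} _ _ _ = s≤s (s≤s z≤n)

first-of-even : ∀ {n} → 2 ∣ n → ConsecutiveDivisors n 1 2
first-of-even 2∣n = 1∣ _ , 2∣n , ≤-refl , λ { _ _ (s≤s (s≤s _)) (s≤s (s≤s ())) }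

last-of-even : ∀ {n d} → 0 < n → 2 ∣ n → ConsecutiveDivisors n d n → n ≡ 2 * d
last-of-even () (divides zero refl) _
last-of-even {d = d} 0<n (divides h@(suc _) refl) (d∣n , _ , d<n , gap) =
  ≤-antisym n≤2d (proper-divisor-bound 0<n d∣n (<⇒≢ d<n))
  where
  h≤d : h ≤ d
  h≤d = ≮⇒≥ (λ d<h → gap h (m∣m*n 2) d<h (m<m*n h 2 ≤-refl))
  n≤2d : h * 2 ≤ 2 * d
  n≤2d = subst (_≤ 2 * d) (*-comm 2 h) (*-monoʳ-≤ 2 h≤d)

record Crossing (m c a : ℕ) : Set where
  field
    lower upper  : ℕ
    consecutive  : ConsecutiveDivisors m lower upper
    lower-below  : lower * c ≤ a
    upper-above  : a < upper * c

-- Scan e = d + 1, d + 2, …, m upward from a divisor d below the level,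
-- keeping d as the last divisor met; k = m ∸ e bounds the remaining scan.
crossing-scan : ∀ {m c a} k d e → e + k ≡ m → d ∣ m → d < e →
  d * c ≤ a → a < m * c → DivisorGap m d e → Crossing m c a
crossing-scan {m} zero d e e+0≡m d∣m d<e below above gap =
  record { consecutive = d∣m , subst (_∣ m) e≡m ∣-refl , d<e , gap
         ; lower-below = below ; upper-above = subst (λ x → _ < x * _) e≡m above }
  where
  e≡m : m ≡ e
  e≡m = trans (sym e+0≡m) (+-identityʳ e)
crossing-scan {m} {c} {a} (suc k) d e e+k≡m d∣m d<e below above gap with e ∣? m
... | no e∤m = crossing-scan k d (suc e) (trans (sym (+-suc e k)) e+k≡m)
                 d∣m (m<n⇒m<1+n d<e) below above (gap-extend gap e∤m)
... | yes e∣m with a <? e * c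
...   | yes a<ec = record { consecutive = d∣m , e∣m , d<e , gap
                          ; lower-below = below ; upper-above = a<ec }
...   | no a≮ec = crossing-scan k e (suc e) (trans (sym (+-suc e k)) e+k≡m)
                    e∣m ≤-refl (≮⇒≥ a≮ec) above gap-succ

crossing : ∀ {m c a} → c ≤ a → a < m * c → Crossing m c a
crossing {m} {c} c≤a a<mc =
  crossing-scan (m ∸ 2) 1 2 (m+[n∸m]≡n 1<m) (1∣ m) ≤-refl below a<mc gap-succ
  where
  below : 1 * c ≤ _
  below = subst (_≤ _) (sym (*-identityˡ c)) c≤a
  1<m : 1 < m
  1<m = *-cancelʳ-< c 1 m (≤-<-trans below a<mc)

double-≤ : ∀ {c a} d → d * c ≤ a → 2 * d * c ≤ 2 * a
double-≤ {c} {a} d dc≤a = subst (_≤ 2 * a) (sym (*-assoc 2 d c)) (*-monoʳ-≤ 2 dc≤a)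

open Strictly2Dense

-- In a strictly 2-dense m, the upper end d₁ of a divisor gap d₀ < d₁
-- starting at or below a (in units of c) stays below 2a: the gap has ratio
-- < 2 unless it is the gap 1 < 2 (then use c < a) or the gap m/2 < m
-- (excluded by 2a < m c).
crossing-upper-bound : ∀ {m c a d₀ d₁} .{{_ : NonZero c}} → Strictly2Dense m →
  c < a → 2 * a < m * c → ConsecutiveDivisors m d₀ d₁ → d₀ * c ≤ a →
  d₁ * c < 2 * a
crossing-upper-bound {m} {c} {a} {d₀} {d₁} S c<a 2a<mc cons below
  with d₀ ≟ 1 | d₁ ≟ m
... | yes refl | _ rewrite successor-unique cons (first S) = *-monoʳ-< 2 c<a
... | no _ | yes refl = ⊥-elim (<-irrefl refl (<-≤-trans 2a<mc
  (subst (λ x → x * c ≤ 2 * a) (sym (last S d₀ cons)) (double-≤ d₀ below))))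
... | no d₀≢1 | no d₁≢m =
  <-≤-trans (*-monoˡ-< c (inner S d₀ d₁ cons d₀≢1 d₁≢m)) (double-≤ d₀ below)

approximation : ∀ {m c a} .{{_ : NonZero c}} → Strictly2Dense m →
  c < a → 2 * a < m * c → ∃[ k ] k ∣ m × a < k * c × k * c < 2 * a
approximation {m} {a = a} S c<a 2a<mc =
  upper , proj₁ (proj₂ consecutive) , upper-above ,
  crossing-upper-bound S c<a 2a<mc consecutive lower-below
  where
  open Crossing (crossing {m} (<⇒≤ c<a) (≤-<-trans (m≤m+n a (a + 0)) 2a<mc))

-- If p < d approximate d by multiples of p; else if 2d < m approximate d by
-- divisors of m; otherwise m ≤ 2d, and e = p works for d < p while e = m
-- works for d = p (m ≠ 2p because p ∤ m).
divisor-between : ∀ {m p d} .{{_ : NonZero p}} → Strictly2Dense m →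
  p < m → ¬ p ∣ m → 1 < d → 2 * d < m * p →
  ∃[ e ] e ∣ m * p × d < e × e < 2 * d
divisor-between {m} {p} {d} S p<m p∤m 1<d 2d<mp with p <? d
... | yes p<d with approximation S p<d 2d<mp
...   | k , k∣m , d<kp , kp<2d = k * p , *-monoˡ-∣ p k∣m , d<kp , kp<2d
divisor-between {m} {p} {d} S p<m p∤m 1<d 2d<mp | no p≮d with 2 * d <? m
... | yes 2d<m with approximation S 1<d (subst (2 * d <_) (sym (*-identityʳ m)) 2d<m)
...   | k , k∣m , d<k1 , k1<2d =
  k , ∣-trans k∣m (m∣m*n p) , subst (d <_) (*-identityʳ k) d<k1 ,
  subst (_< 2 * d) (*-identityʳ k) k1<2d
divisor-between {m} {p} {d} S p<m p∤m 1<d 2d<mp | no p≮d | no 2d≮m with d <? p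
... | yes d<p = p , n∣m*n m , d<p , <-≤-trans p<m (≮⇒≥ 2d≮m)
... | no d≮p = m , m∣m*n p , ≤-<-trans (≮⇒≥ p≮d) p<m ,
  ≤∧≢⇒< (≮⇒≥ 2d≮m) (λ m≡2d → p∤m (divides 2 (trans m≡2d (cong (2 *_) d≡p))))
  where
  d≡p : d ≡ p
  d≡p = ≤-antisym (≮⇒≥ p≮d) (≮⇒≥ d≮p)

squarefree-cofactor : ∀ {m p} → Squarefree (m * p) → 1 < p → ¬ p ∣ m
squarefree-cofactor {m} {p} sqf 1<p (divides q m≡qp) =
  <⇒≢ 1<p (sym (sqf p (divides q (trans (cong (_* p) m≡qp) (*-assoc q p p)))))

lemma5p6 : (n p : ℕ) → 1 < n → Squarefree n → IsLargestPrimeFactor p n →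
    (∀ m → n ≡ m * p → Strictly2Dense m) → p * p < n → Strictly2Dense n
lemma5p6 n p 1<n sqf (p-prime , divides m n≡mp , _) m-dense pp<n = record
  { inner = inner-gap ; first = first-of-even 2∣n ; last = λ _ → last-of-even 0<n 2∣n }
  where
  instance
    p≢0 : NonZero p
    p≢0 = prime⇒nonZero p-prime
  S : Strictly2Dense m
  S = m-dense m n≡mp
  0<n : 0 < n
  0<n = <-trans (s≤s z≤n) 1<n
  2∣n : 2 ∣ n
  2∣n = ∣-trans (proj₁ (proj₂ (first S))) (subst (m ∣_) (sym n≡mp) (m∣m*n p))
  p<m : p < m
  p<m = *-cancelʳ-< p p m (subst (p * p <_) n≡mp pp<n)
  p∤m : ¬ p ∣ m
  p∤m = squarefree-cofactor (subst Squarefree n≡mp sqf)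
          (nonTrivial⇒n>1 p {{prime⇒nonTrivial p-prime}})
  inner-gap : ∀ d d' → ConsecutiveDivisors n d d' → d ≢ 1 → d' ≢ n → d' < 2 * d
  inner-gap d d' cons@(d∣n , _) d≢1 d'≢n =
    let e , e∣mp , d<e , e<2d = divisor-between S p<m p∤m
          (nontrivial-divisor 0<n d∣n d≢1)
          (subst (2 * d <_) n≡mp (inner-gap-below-half 0<n cons d'≢n))
    in successor-bound cons (subst (e ∣_) (sym n≡mp) e∣mp) d<e e<2d
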